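{- Let $p, q$ be distinct primes. In the rotating-table game with $n = p$ counters counting modulo $m = q$, the player cannot win.
   Context: The rotating-table game with parameters $(n,m)$: $n$ counters lie on the vertices (positions $1,\dots,n$, fixed from the player's perspective) of a regular $n$-gon table, each showing an element of $\mathbb{Z}_m$; the initial configuration in $\mathbb{Z}_m^n$ is arbitrary and unknown to the blindfolded player, who receives no information. Each turn the player makes a move $y \in \mathbb{Z}_m^n$, adding $y_i$ to the counter at position $i$; then the table is rotated by an arbitrary (adversarially chosen) rotation, i.e. the counters are cyclically shifted by any amount (possibly zero). A strategy is a fixed finite sequence of moves. The player "can win" if some finite sequence of moves guarantees that, for every initial configuration and every choice of rotations, at some point (initially or after some move) all counters simultaneously show $0$. -}

module Defs where

open import Data.Nat using (ℕ; zero; suc; _+_)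
open import Data.Nat.DivMod using (_mod_)
open import Data.Fin using (Fin; toℕ)
open import Data.List using (List; []; _∷_; length)
open import Data.Vec using (Vec; []; _∷_)
open import Data.Product using (∃; Σ; _,_)
open import Data.Sum using (_⊎_)
open import Relation.Binary.PropositionalEquality using (_≡_)

_⊕_ : ∀ {m} → Fin m → Fin m → Fin m
_⊕_ {suc k} a b = (toℕ a + toℕ b) mod (suc k)

-- A configuration of the table: counter value at each (fixed) position 1..n.
Config : ℕ → ℕ → Set
Config n m = Fin n → Fin m

applyMove : ∀ {n m} → Config n m → Config n m → Config n m
applyMove c y i = c i ⊕ y i

rotate : ∀ {n m} → Fin n → Config n m → Config n m
rotate r c i = c (i ⊕ r)

AllZero : ∀ {n m} → Config n m → Set
AllZero c = ∀ i → toℕ (c i) ≡ 0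

ReachesZero : ∀ {n m} → Config n m → (ys : List (Config n m))
            → Vec (Fin n) (length ys) → Set
ReachesZero c []       []       = AllZero c
ReachesZero c (y ∷ ys) (r ∷ rs) =
  AllZero c ⊎ ReachesZero (rotate r (applyMove c y)) ys rs

Winning : ∀ {n m} → List (Config n m) → Set
Winning {n} {m} ys =
  (c : Config n m) (rs : Vec (Fin n) (length ys)) → ReachesZero c ys rs

CanWin : ℕ → ℕ → Set
CanWin n m = ∃ λ (ys : List (Config n m)) → Winning ys

-- The adversary keeps the configuration non-constant, and a non-constant
-- configuration is never all zero.  Working backwards from the end of a strategy,
-- let x be the non-constant configuration that must result from the move y.  Any
-- rotation s can be undone by the adversary, so it suffices that the configuration
-- j ↦ x (j + s) − y j be non-constant for some s.  If this fails for s = 0 and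
-- s = 1, then x (j + 1) − x j is the same residue d for all j; going once around
-- the table gives p d ≡ 0 (mod q), and as p is invertible modulo q, x is constant.
module Submission where

open import Defs
open import Data.Nat as ℕ using (ℕ; zero; suc; _<_; _%_; _/_)
import Data.Nat.Properties as ℕ
open import Data.Nat.DivMod using (_mod_; m≡m%n+[m/n]*n; m<n⇒m%n≡m)
open import Data.Nat.Divisibility using (n∣m⇒m%n≡0)
open import Data.Nat.Coprimality as Coprime using (Coprime)
open import Data.Nat.Primality using (Prime; prime⇒irreducible; ¬prime[0]; ¬prime[1])
open import Data.Fin using (Fin; toℕ) renaming (zero to fzero; suc to fsuc)
open import Data.Fin.Properties using (toℕ-injective; toℕ-fromℕ<; toℕ<n; all?)
  renaming (_≟_ to _≟ᶠ_)
open import Data.Integer using (ℤ; +_; 0ℤ; 1ℤ; _+_; _-_; -_; _*_; ∣_∣)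
  renaming (_⊖_ to _⊖ᶻ_)
import Data.Integer.Properties as ℤ
import Data.Integer.Coprimality as ℤ
open import Data.Integer.Divisibility.Signed
  using (_∣_; divides; ∣⇒∣ᵤ; ∣ᵤ⇒∣; ∣m⇒∣-m; ∣m∣n⇒∣m+n; ∣n⇒∣m*n)
open import Data.Integer.Tactic.RingSolver using (solve-∀)
open import Data.List using (List; []; _∷_; length)
open import Data.Vec using (Vec; []; _∷_)
open import Data.Product using (∃-syntax; _×_; _,_)
open import Data.Sum using (inj₁; inj₂)
open import Data.Empty using (⊥-elim)
open import Function using (_∘_)
open import Relation.Nullary using (¬_; Dec; yes; no)
open import Relation.Binary.Bundles using (Setoid)
import Relation.Binary.Reasoning.Setoid
open import Relation.Binary.PropositionalEquality
  using (_≡_; _≢_; refl; sym; trans; cong; subst)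

module Congruence (m : ℕ) where

  -- A record rather than a synonym for + m ∣ a - b, so that a and b can be inferred.
  infix 4 _≈_
  record _≈_ (a b : ℤ) : Set where
    constructor mod∣
    field divides-difference : + m ∣ a - b
  open _≈_ public

  private
    transport : ∀ {e a b} → e ≡ a - b → + m ∣ e → a ≈ b
    transport eq h = mod∣ (subst (+ m ∣_) eq h)

  ≈-reflexive : ∀ {a b} → a ≡ b → a ≈ b
  ≈-reflexive {a} refl = mod∣ (divides 0ℤ (ℤ.+-inverseʳ a))

  ≈-refl : ∀ {a} → a ≈ a
  ≈-refl = ≈-reflexive refl

  ≈-sym : ∀ {a b} → a ≈ b → b ≈ a
  ≈-sym {a} {b} a≈b = transport (negate a b) (∣m⇒∣-m (divides-difference a≈b))
    where
    negate : ∀ a b → - (a - b) ≡ b - a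
    negate = solve-∀

  ≈-trans : ∀ {a b c} → a ≈ b → b ≈ c → a ≈ c
  ≈-trans {a} {b} {c} a≈b b≈c =
    transport (telescope a b c) (∣m∣n⇒∣m+n (divides-difference a≈b) (divides-difference b≈c))
    where
    telescope : ∀ a b c → (a - b) + (b - c) ≡ a - c
    telescope = solve-∀

  ≈-setoid : Setoid _ _
  ≈-setoid = record
    { Carrier = ℤ
    ; _≈_ = _≈_
    ; isEquivalence = record { refl = ≈-refl ; sym = ≈-sym ; trans = ≈-trans }
    }

  module ≈-Reasoning = Relation.Binary.Reasoning.Setoid ≈-setoid

  +-cong : ∀ {a b c d} → a ≈ b → c ≈ d → a + c ≈ b + d
  +-cong {a} {b} {c} {d} a≈b c≈d =
    transport (interchange a b c d) (∣m∣n⇒∣m+n (divides-difference a≈b) (divides-difference c≈d))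
    where
    interchange : ∀ a b c d → (a - b) + (c - d) ≡ (a + c) - (b + d)
    interchange = solve-∀

  +-congˡ : ∀ c {a b} → a ≈ b → c + a ≈ c + b
  +-congˡ c = +-cong (≈-refl {c})

  +-congʳ : ∀ c {a b} → a ≈ b → a + c ≈ b + c
  +-congʳ c a≈b = +-cong a≈b (≈-refl {c})

  i+j*0≡i : ∀ a k → a + k * 0ℤ ≡ a
  i+j*0≡i = solve-∀

  m≈0 : + m ≈ 0ℤ
  m≈0 = mod∣ (divides 1ℤ (trans (ℤ.+-identityʳ (+ m)) (sym (ℤ.*-identityˡ (+ m)))))

  *-congˡ : ∀ k {a b} → a ≈ b → k * a ≈ k * b
  *-congˡ k {a} {b} a≈b = transport (distrib k a b) (∣n⇒∣m*n k (divides-difference a≈b))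
    where
    distrib : ∀ k a b → k * (a - b) ≡ k * a - k * b
    distrib = solve-∀

  +-cancelˡ : ∀ k {a b} → k + a ≈ k + b → a ≈ b
  +-cancelˡ k {a} {b} k+a≈k+b = transport (cancel k a b) (divides-difference k+a≈k+b)
    where
    cancel : ∀ k a b → (k + a) - (k + b) ≡ a - b
    cancel = solve-∀

  *-cancelˡ : ∀ {n} → Coprime n m → ∀ {a b} → + n * a ≈ + n * b → a ≈ b
  *-cancelˡ {n} coprime {a} {b} na≈nb =
    mod∣ (∣ᵤ⇒∣ (ℤ.coprime-divisor (+ m) (+ n) (a - b) (Coprime.sym coprime) (∣⇒∣ᵤ m∣n[a-b])))
    where
    factor : ∀ k a b → k * a - k * b ≡ k * (a - b)
    factor = solve-∀
    m∣n[a-b] : + m ∣ + n * (a - b)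
    m∣n[a-b] = subst (+ m ∣_) (factor (+ n) a b) (divides-difference na≈nb)

  arithmetic-progression : ∀ (X : ℕ → ℤ) d → (∀ i → X (suc i) ≈ X i + d) →
                           ∀ i → X i ≈ X 0 + + i * d
  arithmetic-progression X d step zero = ≈-reflexive (sym (ℤ.+-identityʳ (X 0)))
  arithmetic-progression X d step (suc i) = begin
    X (suc i)              ≈⟨ step i ⟩
    X i + d                ≈⟨ +-congʳ d (arithmetic-progression X d step i) ⟩
    X 0 + + i * d + d      ≡⟨ shift (X 0) (+ i) d ⟩
    X 0 + (1ℤ + + i) * d   ≡⟨ cong (λ j → X 0 + j * d) (ℤ.pos-+ 1 i) ⟨
    X 0 + + suc i * d      ∎
    where
    open ≈-Reasoning
    shift : ∀ x i d → x + i * d + d ≡ x + (1ℤ + i) * d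
    shift = solve-∀

  periodic-progression-constant : ∀ {n} → Coprime n m → ∀ (X : ℕ → ℤ) d → X n ≡ X 0 →
                                  (∀ i → X (suc i) ≈ X i + d) → ∀ i → X i ≈ X 0
  periodic-progression-constant {n} coprime X d periodic step i = begin
    X i                ≈⟨ progression i ⟩
    X 0 + + i * d      ≈⟨ +-congˡ (X 0) (*-congˡ (+ i) d≈0) ⟩
    X 0 + + i * 0ℤ     ≡⟨ i+j*0≡i (X 0) (+ i) ⟩
    X 0                ∎
    where
    open ≈-Reasoning
    progression : ∀ i → X i ≈ X 0 + + i * d
    progression = arithmetic-progression X d step
    d≈0 : d ≈ 0ℤ
    d≈0 = *-cancelˡ coprime (+-cancelˡ (X 0) (begin
      X 0 + + n * d    ≈⟨ ≈-sym (progression n) ⟩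
      X n              ≡⟨ periodic ⟩
      X 0              ≡⟨ i+j*0≡i (X 0) (+ n) ⟨
      X 0 + + n * 0ℤ   ∎))

module Residues (k : ℕ) where

  private
    M : ℕ
    M = suc k

  open Congruence M public

  toℤ : Fin M → ℤ
  toℤ a = + toℕ a

  toℤ-mod : ∀ a → toℤ (a mod M) ≈ + a
  toℤ-mod a = ≈-sym (begin
    + a                              ≡⟨ cong +_ (m≡m%n+[m/n]*n a M) ⟩
    + (a % M ℕ.+ a / M ℕ.* M)        ≡⟨ ℤ.pos-+ (a % M) (a / M ℕ.* M) ⟩
    + (a % M) + + (a / M ℕ.* M)      ≡⟨ cong (λ t → + (a % M) + t) (ℤ.pos-* (a / M) M) ⟩
    + (a % M) + + (a / M) * + M      ≈⟨ +-congˡ (+ (a % M)) (*-congˡ (+ (a / M)) m≈0) ⟩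
    + (a % M) + + (a / M) * 0ℤ       ≡⟨ i+j*0≡i (+ (a % M)) (+ (a / M)) ⟩
    + (a % M)                        ≡⟨ cong +_ (toℕ-fromℕ< _) ⟨
    toℤ (a mod M)                    ∎)
    where open ≈-Reasoning

  toℤ-⊕ : ∀ a b → toℤ (a ⊕ b) ≈ toℤ a + toℤ b
  toℤ-⊕ a b = ≈-trans (toℤ-mod (toℕ a ℕ.+ toℕ b)) (≈-reflexive (ℤ.pos-+ (toℕ a) (toℕ b)))

  toℤ-injective : ∀ {a b} → toℤ a ≈ toℤ b → a ≡ b
  toℤ-injective {a} {b} (mod∣ M∣a-b) =
    toℕ-injective (ℤ.+-injective (ℤ.i-j≡0⇒i≡j _ _ (ℤ.∣i∣≡0⇒i≡0 distance≡0)))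
    where
    distance<M : ∣ toℤ a - toℤ b ∣ < M
    distance<M = subst (_< M) (cong ∣_∣ (sym (ℤ.m-n≡m⊖n (toℕ a) (toℕ b))))
      (ℕ.≤-<-trans (ℤ.∣m⊝n∣≤m⊔n (toℕ a) (toℕ b)) (ℕ.⊔-lub (toℕ<n a) (toℕ<n b)))
    distance≡0 : ∣ toℤ a - toℤ b ∣ ≡ 0
    distance≡0 = trans (sym (m<n⇒m%n≡m distance<M)) (n∣m⇒m%n≡0 _ M (∣⇒∣ᵤ M∣a-b))

  infixl 6 _⊖_
  neg : Fin M → Fin M
  neg b = (M ℕ.∸ toℕ b) mod M

  _⊖_ : Fin M → Fin M → Fin M
  a ⊖ b = a ⊕ neg b

  toℤ-neg : ∀ b → toℤ (neg b) ≈ - toℤ b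
  toℤ-neg b = begin
    toℤ (neg b)          ≈⟨ toℤ-mod (M ℕ.∸ toℕ b) ⟩
    + (M ℕ.∸ toℕ b)      ≡⟨ ℤ.⊖-≥ (ℕ.<⇒≤ (toℕ<n b)) ⟨
    M ⊖ᶻ toℕ b          ≡⟨ ℤ.m-n≡m⊖n M (toℕ b) ⟨
    + M - toℤ b          ≈⟨ +-congʳ (- toℤ b) m≈0 ⟩
    0ℤ - toℤ b           ≡⟨ ℤ.+-identityˡ (- toℤ b) ⟩
    - toℤ b              ∎
    where open ≈-Reasoning

  ⊖-⊕-cancel : ∀ a b → (a ⊖ b) ⊕ b ≡ a
  ⊖-⊕-cancel a b = toℤ-injective (begin
    toℤ ((a ⊖ b) ⊕ b)              ≈⟨ toℤ-⊕ (a ⊖ b) b ⟩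
    toℤ (a ⊖ b) + toℤ b            ≈⟨ +-congʳ (toℤ b) (toℤ-⊕ a (neg b)) ⟩
    toℤ a + toℤ (neg b) + toℤ b    ≈⟨ +-congʳ (toℤ b) (+-congˡ (toℤ a) (toℤ-neg b)) ⟩
    toℤ a - toℤ b + toℤ b          ≡⟨ cancel (toℤ a) (toℤ b) ⟩
    toℤ a                          ∎)
    where
    open ≈-Reasoning
    cancel : ∀ a b → a - b + b ≡ a
    cancel = solve-∀

  mod-⊕ : ∀ a b → (a mod M) ⊕ (b mod M) ≡ (a ℕ.+ b) mod M
  mod-⊕ a b = toℤ-injective (begin
    toℤ ((a mod M) ⊕ (b mod M))          ≈⟨ toℤ-⊕ (a mod M) (b mod M) ⟩
    toℤ (a mod M) + toℤ (b mod M)        ≈⟨ +-cong (toℤ-mod a) (toℤ-mod b) ⟩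
    + a + + b                            ≡⟨ ℤ.pos-+ a b ⟨
    + (a ℕ.+ b)                          ≈⟨ ≈-sym (toℤ-mod (a ℕ.+ b)) ⟩
    toℤ ((a ℕ.+ b) mod M)                ∎)
    where open ≈-Reasoning

  toℕ-mod : ∀ a → toℕ a mod M ≡ a
  toℕ-mod a = toℤ-injective (toℤ-mod (toℕ a))

  mod-self : M mod M ≡ 0 mod M
  mod-self = toℤ-injective (≈-trans (toℤ-mod M) (≈-trans m≈0 (≈-sym (toℤ-mod 0))))

Constant : ∀ {n} {A : Set} → (Fin (suc n) → A) → Set
Constant f = ∀ i → f i ≡ f fzero

constant? : ∀ {n m} (c : Config (suc n) m) → Dec (Constant c)
constant? c = all? (λ i → c i ≟ᶠ c fzero)

allZero⇒constant : ∀ {n m} {c : Config (suc n) m} → AllZero c → Constant c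
allZero⇒constant allZero i = toℕ-injective (trans (allZero i) (sym (allZero fzero)))

ReachesZero-resp : ∀ {n m} (ys : List (Config n m)) (rs : Vec (Fin n) (length ys)) {c c′ : Config n m} →
                   (∀ i → c i ≡ c′ i) → ReachesZero c ys rs → ReachesZero c′ ys rs
ReachesZero-resp [] [] c≗c′ allZero i = trans (cong toℕ (sym (c≗c′ i))) (allZero i)
ReachesZero-resp (y ∷ ys) (r ∷ rs) c≗c′ (inj₁ allZero) =
  inj₁ (λ i → trans (cong toℕ (sym (c≗c′ i))) (allZero i))
ReachesZero-resp (y ∷ ys) (r ∷ rs) c≗c′ (inj₂ reaches) =
  inj₂ (ReachesZero-resp ys rs (λ i → cong (_⊕ y (i ⊕ r)) (c≗c′ (i ⊕ r))) reaches)

module _ {n k : ℕ} where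

  private
    N M : ℕ
    N = suc n
    M = suc k
    module Pos = Residues n
    module Val = Residues k

  preimage : Config N M → Config N M → Fin N → Config N M
  preimage x y s j = x (j ⊕ s) Val.⊖ y j

  rotate-applyMove-preimage : ∀ x y s i → rotate (Pos.neg s) (applyMove (preimage x y s) y) i ≡ x i
  rotate-applyMove-preimage x y s i =
    trans (Val.⊖-⊕-cancel _ (y (i ⊕ Pos.neg s))) (cong x (Pos.⊖-⊕-cancel i s))

  preimages-constant⇒constant : Coprime N M → ∀ x y → Constant (preimage x y (0 mod N)) →
                                Constant (preimage x y (1 mod N)) → Constant x
  preimages-constant⇒constant coprime x y constant₀ constant₁ j = Val.toℤ-injective (begin
    toℤ (x j)    ≡⟨ cong (toℤ ∘ x) (Pos.toℕ-mod j) ⟨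
    X (toℕ j)    ≈⟨ Val.periodic-progression-constant coprime X d periodic step (toℕ j) ⟩
    X 0          ∎)
    where
    open Val using (toℤ)
    open Val.≈-Reasoning
    X Y : ℕ → ℤ
    X i = toℤ (x (i mod N))
    Y i = toℤ (y (i mod N))
    offset : ℕ → ℤ
    offset s = toℤ (preimage x y (s mod N) fzero)
    d : ℤ
    d = offset 1 - offset 0
    periodic : X N ≡ X 0
    periodic = cong (toℤ ∘ x) Pos.mod-self
    shifted : ∀ s → Constant (preimage x y (s mod N)) → ∀ i → X (i ℕ.+ s) Val.≈ offset s + Y i
    shifted s constant i = begin
      X (i ℕ.+ s)                ≡⟨ cong (toℤ ∘ x) (Pos.mod-⊕ i s) ⟨
      toℤ (x (i′ ⊕ (s mod N)))   ≡⟨ cong toℤ (Val.⊖-⊕-cancel _ (y i′)) ⟨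
      toℤ (c i′ ⊕ y i′)          ≡⟨ cong (λ c₀ → toℤ (c₀ ⊕ y i′)) (constant i′) ⟩
      toℤ (c fzero ⊕ y i′)       ≈⟨ Val.toℤ-⊕ (c fzero) (y i′) ⟩
      offset s + Y i             ∎
      where
      i′ : Fin N
      i′ = i mod N
      c : Config N M
      c = preimage x y (s mod N)
    step : ∀ i → X (suc i) Val.≈ X i + d
    step i = begin
      X (suc i)            ≡⟨ cong X (ℕ.+-comm 1 i) ⟩
      X (i ℕ.+ 1)          ≈⟨ shifted 1 constant₁ i ⟩
      offset 1 + Y i       ≡⟨ rearrange (offset 0) (offset 1) (Y i) ⟩
      offset 0 + Y i + d   ≈⟨ Val.+-congʳ d (Val.≈-sym (shifted 0 constant₀ i)) ⟩
      X (i ℕ.+ 0) + d      ≡⟨ cong (λ i′ → X i′ + d) (ℕ.+-identityʳ i) ⟩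
      X i + d              ∎
      where
      rearrange : ∀ a b y → b + y ≡ a + y + (b - a)
      rearrange = solve-∀

  choose-rotation : Coprime N M → ∀ x y → ¬ Constant x → ∃[ s ] ¬ Constant (preimage x y s)
  choose-rotation coprime x y ¬constant with constant? (preimage x y (0 mod N))
  ... | no ¬constant₀ = 0 mod N , ¬constant₀
  ... | yes constant₀ = 1 mod N , λ constant₁ →
    ¬constant (preimages-constant⇒constant coprime x y constant₀ constant₁)

module _ {n k : ℕ} (coprime : Coprime (2 ℕ.+ n) (2 ℕ.+ k)) where

  private
    module Pos = Residues (suc n)

  nonconstant : Config (2 ℕ.+ n) (2 ℕ.+ k)
  nonconstant fzero    = fzero
  nonconstant (fsuc _) = fsuc fzero

  ¬constant-nonconstant : ¬ Constant nonconstant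
  ¬constant-nonconstant constant with constant (fsuc fzero)
  ... | ()

  adversary : (ys : List (Config (2 ℕ.+ n) (2 ℕ.+ k))) →
              ∃[ c ] ∃[ rs ] ¬ Constant c × ¬ ReachesZero c ys rs
  adversary [] = nonconstant , [] , ¬constant-nonconstant , ¬constant-nonconstant ∘ allZero⇒constant
  adversary (y ∷ ys) with adversary ys
  ... | x , rs , ¬constant-x , ¬reaches with choose-rotation coprime x y ¬constant-x
  ... | s , ¬constant-c = preimage x y s , Pos.neg s ∷ rs , ¬constant-c , λ where
    (inj₁ allZero) → ¬constant-c (allZero⇒constant allZero)
    (inj₂ reaches) → ¬reaches (ReachesZero-resp ys rs (rotate-applyMove-preimage x y s) reaches)

coprime⇒¬canWin : ∀ {n m} → Coprime (2 ℕ.+ n) (2 ℕ.+ m) → ¬ CanWin (2 ℕ.+ n) (2 ℕ.+ m)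
coprime⇒¬canWin coprime (ys , winning) with adversary coprime ys
... | c , rs , _ , ¬reaches = ¬reaches (winning c rs)

distinct-primes-coprime : ∀ {p q} → Prime p → Prime q → p ≢ q → Coprime p q
distinct-primes-coprime prime-p prime-q p≢q (d∣p , d∣q) with prime⇒irreducible prime-p d∣p
... | inj₁ d≡1 = d≡1
... | inj₂ refl with prime⇒irreducible prime-q d∣q
...   | inj₁ refl = ⊥-elim (¬prime[1] prime-p)
...   | inj₂ p≡q  = ⊥-elim (p≢q p≡q)

lemma2p1 : (p q : ℕ) → Prime p → Prime q → p ≢ q → ¬ CanWin p q
lemma2p1 0             q             prime-p = ⊥-elim (¬prime[0] prime-p)
lemma2p1 1             q             prime-p = ⊥-elim (¬prime[1] prime-p)
lemma2p1 (suc (suc p)) 0             prime-p prime-q = ⊥-elim (¬prime[0] prime-q)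
lemma2p1 (suc (suc p)) 1             prime-p prime-q = ⊥-elim (¬prime[1] prime-q)
lemma2p1 (suc (suc p)) (suc (suc q)) prime-p prime-q p≢q =
  coprime⇒¬canWin (distinct-primes-coprime prime-p prime-q p≢q)
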